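{- Let $n\geq 3$ and $v\geq 2$, and let $G$ be a maximal weakly $(n,v)$-clique-partitioned graph. For two distinct cliques $P,Q$ of the unique decomposition of $G$ into $n$ vertex-disjoint $v$-cliques, write $P\to Q$ if some vertex of $P$ is adjacent to no vertex of $Q$. Let $X$, $Y$, $Z$ be three distinct cliques of this decomposition. If $X\to Y$ and $Y\to Z$, then $X\to Z$.
   Context: A $v$-clique is a set of $v$ pairwise adjacent vertices. A graph of order $nv$ is weakly $(n,v)$-clique-partitioned if its vertex set can be decomposed in a unique way into $n$ vertex-disjoint $v$-cliques. Every weakly $(n,v)$-clique-partitioned graph has at most $\binom{nv}{2}-\frac{n(n-1)v}{2}$ edges; one is called maximal if it has exactly this many edges. (In such a maximal graph, for any two distinct cliques $P,Q$ of the decomposition exactly one of $P\to Q$, $Q\to P$ holds.) -}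

module Defs where

open import Data.Nat using (ℕ; _+_; _*_; _∸_; _/_)
open import Data.Nat.Combinatorics using (_C_)
open import Data.Bool using (Bool; true; false)
open import Data.Fin using (Fin; _<_)
open import Data.Fin.Properties using (_≟_)
open import Data.List using (List; length; filter; allFin; concatMap; map)
open import Data.Product using (Σ; ∃; _×_; _,_)
open import Relation.Binary.PropositionalEquality using (_≡_)
open import Relation.Nullary using (¬_)
open import Relation.Nullary.Decidable using (_×-dec_)
open import Data.Bool.Properties using () renaming (_≟_ to _≟B_)
open import Function.Bundles using (_⇔_)

record Graph (N : ℕ) : Set where
  field
    adj   : Fin N → Fin N → Bool
    sym   : ∀ x y → adj x y ≡ adj y x
    irrefl : ∀ x → adj x x ≡ false
open Graph public

allPairs : (N : ℕ) → List (Fin N × Fin N)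
allPairs N = concatMap (λ x → map (λ y → (x , y)) (allFin N)) (allFin N)

edgeCount : {N : ℕ} → Graph N → ℕ
edgeCount {N} G =
  length (filter (λ { (x , y) → (x Data.Fin.<? y) ×-dec (adj G x y ≟B true) }) (allPairs N))
  where import Data.Fin

-- A decomposition of a graph of order n*v into n vertex-disjoint v-cliques,
-- encoded as a labelling c : vertices → Fin n (the clique containing each vertex):
-- every label class has exactly v vertices and distinct vertices with
-- the same label are adjacent.
IsCliqueDecomposition : (n v : ℕ) → Graph (n * v) → (Fin (n * v) → Fin n) → Set
IsCliqueDecomposition n v G c =
  (∀ (i : Fin n) → length (filter (λ x → c x ≟ i) (allFin (n * v))) ≡ v)
  × (∀ x y → c x ≡ c y → ¬ (x ≡ y) → adj G x y ≡ true)

SamePartition : {N n : ℕ} → (Fin N → Fin n) → (Fin N → Fin n) → Set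
SamePartition {N} c c' = ∀ (x y : Fin N) → (c x ≡ c y) ⇔ (c' x ≡ c' y)

WeaklyCliquePartitioned : (n v : ℕ) → Graph (n * v) → Set
WeaklyCliquePartitioned n v G =
  (∃ λ c → IsCliqueDecomposition n v G c)
  × (∀ c c' → IsCliqueDecomposition n v G c → IsCliqueDecomposition n v G c'
       → SamePartition c c')

Maximal : (n v : ℕ) → Graph (n * v) → Set
Maximal n v G = edgeCount G ≡ ((n * v) C 2) ∸ ((n * (n ∸ 1) * v) / 2)

Arrow : {n v : ℕ} → Graph (n * v) → (Fin (n * v) → Fin n) → Fin n → Fin n → Set
Arrow {n} {v} G c P Q =
  ∃ λ (x : Fin (n * v)) → c x ≡ P × (∀ (y : Fin (n * v)) → c y ≡ Q → adj G x y ≡ false)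

-- Write nonAdj P Q for the number of non-adjacent pairs (x , y) with x in clique P and y in clique Q.
-- If some p ∈ P were adjacent to all of Q and some q ∈ Q to all of P, exchanging p and q would give
-- a second decomposition. Hence all vertices of P miss a vertex of Q or vice versa, and so
-- nonAdj P Q ≥ v for all P, Q. Maximality says that there are n(n−1)v/2 non-edges, i.e. the sum of
-- all nonAdj P Q is n²v, so every nonAdj P Q equals v: when every vertex of P misses a vertex of Q,
-- it misses exactly one.
--
-- Let x₀ ∈ X miss all of Y and y₀ ∈ Y miss all of Z. Then y₀ is adjacent to X ∖ {x₀}, and every
-- vertex of Z to Y ∖ {y₀}. If x₀ is adjacent to all of Z except at most one vertex z, moving x₀ to Z,
-- y₀ to X and z to Y gives another decomposition. Otherwise every vertex of Z misses exactly one
-- vertex of X, and x₀ misses a set F ⊆ Z with |F| ≥ 1. If X → Z failed, x₀ would have a neighbour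
-- in Z; counting shows that at least |F| − 1 vertices of X ∖ {x₀} are adjacent to all of Z, and
-- exchanging x₀ and |F| − 1 of them with F again gives another decomposition.

module Submission where

open import Level using (0ℓ)
open import Data.Nat using (ℕ; zero; suc; _+_; _*_; _∸_; _≤_; _<_; z≤n; s≤s; _/_)
open import Data.Nat.Properties
  using (≤-reflexive; ≤-trans; ≤-pred; <⇒≱; ≮⇒≥; +-comm; +-identityʳ; *-comm; *-identityʳ;
         m≤m+n; m≤n+m; +-mono-≤; +-monoˡ-≤; +-monoʳ-≤; +-mono-<-≤; +-mono-≤-<; +-cancelʳ-≡; +-cancelʳ-≤;
         m+n∸m≡n; m+[n∸m]≡n; m≤n+m∸n; m≤n+o⇒m∸n≤o; +-0-commutativeMonoid; module ≤-Reasoning)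
open import Data.Nat.DivMod using (m/n*n≤m)
open import Data.Nat.Combinatorics using (_C_; nC1≡n; nCk+nC[k+1]≡[n+1]C[k+1])
open import Data.Nat.Tactic.RingSolver using (solve-∀)
open import Data.Fin using (Fin; zero; suc)
import Data.Fin as Fin
open import Data.Fin.Properties using (_≟_; _<?_; <-cmp; suc-injective; any?; all?; ¬∀⟶∃¬)
open import Data.List using (List; length; filter; tabulate; allFin; concatMap; _++_)
import Data.List as List
import Data.List.Properties as List
open import Data.Vec.Functional using (_∷_)
open import Data.Product using (∃; _×_; _,_; proj₁; proj₂)
open import Data.Sum using (_⊎_; inj₁; inj₂)
open import Data.Bool using (Bool; true; false; T; if_then_else_)
open import Data.Bool.Properties using (T?; ¬-not; not-¬) renaming (_≟_ to _≟ᵇ_)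
open import Data.Empty using (⊥; ⊥-elim)
open import Function using (_∘_; id)
open import Function.Bundles using (Equivalence)
open import Relation.Binary.Definitions using (tri<; tri≈; tri>)
open import Relation.Binary.PropositionalEquality
open import Relation.Nullary using (Dec; does; yes; no; ¬_; ¬?; contradiction; _×-dec_; _→-dec_)
open import Relation.Nullary.Decidable using (dec-true; dec-false; decidable-stable)
open import Relation.Unary using (Pred; Decidable; _⊆_; _∩_; _∪_; ∁)
open import Relation.Unary.Properties using (_∩?_; _∪?_; ∁?)
open import Algebra.Properties.CommutativeMonoid.Sum +-0-commutativeMonoid
  using (sum; sum-syntax; sum-cong-≗; ∑-distrib-+; ∑-comm; sum-replicate-zero)

open import Defs hiding (sym)

-- Finite sums and counting

sum-zero : ∀ {m} {f : Fin m → ℕ} → (∀ i → f i ≡ 0) → sum f ≡ 0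
sum-zero {m} f≗0 = trans (sum-cong-≗ f≗0) (sum-replicate-zero m)

sum-mono-≤ : ∀ {m} {f g : Fin m → ℕ} → (∀ i → f i ≤ g i) → sum f ≤ sum g
sum-mono-≤ {zero}  f≤g = z≤n
sum-mono-≤ {suc m} f≤g = +-mono-≤ (f≤g zero) (sum-mono-≤ (f≤g ∘ suc))

sum-mono-< : ∀ {m} {f g : Fin m → ℕ} → (∀ i → f i ≤ g i) → ∀ a → f a < g a → sum f < sum g
sum-mono-< f≤g zero    fa<ga = +-mono-<-≤ fa<ga (sum-mono-≤ (f≤g ∘ suc))
sum-mono-< f≤g (suc a) fa<ga = +-mono-≤-< (f≤g zero) (sum-mono-< (f≤g ∘ suc) a fa<ga)

≤-sum : ∀ {m} (f : Fin m → ℕ) a → f a ≤ sum f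
≤-sum f zero    = m≤m+n _ _
≤-sum f (suc a) = ≤-trans (≤-sum (f ∘ suc) a) (m≤n+m _ _)

+-≤-sum : ∀ {m} (f : Fin m → ℕ) {a b} → a ≢ b → f a + f b ≤ sum f
+-≤-sum f {zero}  {zero}  a≢b = contradiction refl a≢b
+-≤-sum f {zero}  {suc b} a≢b = +-monoʳ-≤ (f zero) (≤-sum (f ∘ suc) b)
+-≤-sum f {suc a} {zero}  a≢b =
  ≤-trans (≤-reflexive (+-comm (f (suc a)) (f zero))) (+-monoʳ-≤ (f zero) (≤-sum (f ∘ suc) a))
+-≤-sum f {suc a} {suc b} a≢b = ≤-trans (+-≤-sum (f ∘ suc) (a≢b ∘ cong suc)) (m≤n+m _ _)

sum-single : ∀ {m} (f : Fin m → ℕ) a → (∀ x → x ≢ a → f x ≡ 0) → sum f ≡ f a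
sum-single f zero    f≗0 = trans (cong (f zero +_) (sum-zero (λ x → f≗0 (suc x) λ ()))) (+-identityʳ _)
sum-single f (suc a) f≗0 rewrite f≗0 zero (λ ()) =
  sum-single (f ∘ suc) a (λ x x≢a → f≗0 (suc x) (x≢a ∘ suc-injective))

sum-const : ∀ m k → ∑[ _ < m ] k ≡ m * k
sum-const zero    k = refl
sum-const (suc m) k = cong (k +_) (sum-const m k)

∑∑-cong : ∀ {a b} {f g : Fin a → Fin b → ℕ} → (∀ i j → f i j ≡ g i j) →
          ∑[ i < a ] ∑[ j < b ] f i j ≡ ∑[ i < a ] ∑[ j < b ] g i j
∑∑-cong f≗g = sum-cong-≗ (λ i → sum-cong-≗ (f≗g i))

∑∑-distrib-+ : ∀ {a b} (f g : Fin a → Fin b → ℕ) →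
  ∑[ i < a ] ∑[ j < b ] (f i j + g i j) ≡ ∑[ i < a ] ∑[ j < b ] f i j + ∑[ i < a ] ∑[ j < b ] g i j
∑∑-distrib-+ {a} {b} f g = trans (sum-cong-≗ (λ i → ∑-distrib-+ {b} (f i) (g i))) (∑-distrib-+ {a} _ _)

∑∑-comm : ∀ {a b c d} (f : Fin a → Fin b → Fin c → Fin d → ℕ) →
  ∑[ i < a ] ∑[ j < b ] ∑[ k < c ] ∑[ l < d ] f i j k l ≡
  ∑[ k < c ] ∑[ l < d ] ∑[ i < a ] ∑[ j < b ] f i j k l
∑∑-comm {a} {b} {c} {d} f = begin
  ∑[ i < a ] ∑[ j < b ] ∑[ k < c ] ∑[ l < d ] f i j k l
    ≡⟨ sum-cong-≗ (λ i → ∑-comm {b} {c} (λ j k → ∑[ l < d ] f i j k l)) ⟩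
  ∑[ i < a ] ∑[ k < c ] ∑[ j < b ] ∑[ l < d ] f i j k l
    ≡⟨ sum-cong-≗ (λ i → sum-cong-≗ (λ k → ∑-comm {b} {d} (λ j l → f i j k l))) ⟩
  ∑[ i < a ] ∑[ k < c ] ∑[ l < d ] ∑[ j < b ] f i j k l
    ≡⟨ ∑-comm {a} {c} (λ i k → ∑[ l < d ] ∑[ j < b ] f i j k l) ⟩
  ∑[ k < c ] ∑[ i < a ] ∑[ l < d ] ∑[ j < b ] f i j k l
    ≡⟨ sum-cong-≗ (λ k → ∑-comm {a} {d} (λ i l → ∑[ j < b ] f i j k l)) ⟩
  ∑[ k < c ] ∑[ l < d ] ∑[ i < a ] ∑[ j < b ] f i j k l ∎
  where open ≡-Reasoning

-- Only `does` is inspected, so that 𝟙 (suc x <? suc y) reduces to 𝟙 (x <? y).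
𝟙 : ∀ {A : Set} → Dec A → ℕ
𝟙 a? = if does a? then 1 else 0

𝟙-yes : ∀ {A : Set} (a? : Dec A) → A → 𝟙 a? ≡ 1
𝟙-yes (yes _) _ = refl
𝟙-yes (no ¬a) a = contradiction a ¬a

𝟙-no : ∀ {A : Set} (a? : Dec A) → ¬ A → 𝟙 a? ≡ 0
𝟙-no (yes a) ¬a = contradiction a ¬a
𝟙-no (no _)  _  = refl

𝟙-≤ : ∀ {A : Set} (a? : Dec A) {n} → (A → 1 ≤ n) → 𝟙 a? ≤ n
𝟙-≤ (yes a) 1≤n = 1≤n a
𝟙-≤ (no _)  _   = z≤n

≤-𝟙 : ∀ {A : Set} (a? : Dec A) {n} → (A → n ≤ 1) → (¬ A → n ≡ 0) → n ≤ 𝟙 a?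
≤-𝟙 (yes a)  n≤1 _   = n≤1 a
≤-𝟙 (no ¬a)  _   n≡0 = ≤-reflexive (n≡0 ¬a)

𝟙-cong : ∀ {A B : Set} (a? : Dec A) (b? : Dec B) → (A → B) → (B → A) → 𝟙 a? ≡ 𝟙 b?
𝟙-cong (yes a) b? A→B _ = sym (𝟙-yes b? (A→B a))
𝟙-cong (no ¬a) b? _ B→A = sym (𝟙-no b? (¬a ∘ B→A))

∑-𝟙-≟×-dec : ∀ {k} (a : Fin k) {A : Set} (a? : Dec A) → ∑[ i < k ] 𝟙 ((a ≟ i) ×-dec a?) ≡ 𝟙 a?
∑-𝟙-≟×-dec a a? = trans (sum-single _ a off-a) (𝟙-cong ((a ≟ a) ×-dec a?) a? (λ (_ , x) → x) (refl ,_))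
  where
  off-a : ∀ i → i ≢ a → 𝟙 ((a ≟ i) ×-dec a?) ≡ 0
  off-a i i≢a = 𝟙-no ((a ≟ i) ×-dec a?) (λ (a≡i , _) → i≢a (sym a≡i))

count : ∀ {m} {P : Pred (Fin m) 0ℓ} → Decidable P → ℕ
count {m} P? = ∑[ x < m ] 𝟙 (P? x)

count-mono : ∀ {m} {P Q : Pred (Fin m) 0ℓ} (P? : Decidable P) (Q? : Decidable Q) →
             P ⊆ Q → count P? ≤ count Q?
count-mono P? Q? P⊆Q = sum-mono-≤ λ x → 𝟙-≤ (P? x) λ px → ≤-reflexive (sym (𝟙-yes (Q? x) (P⊆Q px)))

count-empty : ∀ {m} {P : Pred (Fin m) 0ℓ} (P? : Decidable P) → (∀ x → ¬ P x) → count P? ≡ 0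
count-empty P? ¬P = sum-zero λ x → 𝟙-no (P? x) (¬P x)

count-unique : ∀ {m} {P : Pred (Fin m) 0ℓ} (P? : Decidable P) {a} → P a → (∀ {x} → P x → x ≡ a) →
               count P? ≡ 1
count-unique P? {a} pa unique =
  trans (sum-single (𝟙 ∘ P?) a λ x x≢a → 𝟙-no (P? x) (x≢a ∘ unique)) (𝟙-yes (P? a) pa)

count-singleton : ∀ {m} (a : Fin m) → count (_≟ a) ≡ 1
count-singleton a = count-unique (_≟ a) refl id

count-≤1 : ∀ {m} {P : Pred (Fin m) 0ℓ} (P? : Decidable P) → (∀ {x y} → P x → P y → x ≡ y) →
           count P? ≤ 1
count-≤1 P? unique with any? P?
... | yes (a , pa) = ≤-reflexive (count-unique P? pa (λ px → unique px pa))
... | no ¬∃P       = ≤-trans (≤-reflexive (count-empty P? (λ x px → ¬∃P (x , px)))) z≤n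

count-split : ∀ {m} {P Q : Pred (Fin m) 0ℓ} (P? : Decidable P) (Q? : Decidable Q) →
              count P? ≡ count (P? ∩? Q?) + count (P? ∩? ∁? Q?)
count-split {m} P? Q? = trans (sum-cong-≗ pointwise) (∑-distrib-+ {m} _ _)
  where
  pointwise : ∀ x → 𝟙 (P? x) ≡ 𝟙 ((P? ∩? Q?) x) + 𝟙 ((P? ∩? ∁? Q?) x)
  pointwise x with P? x | Q? x
  ... | yes _ | yes _ = refl
  ... | yes _ | no _  = refl
  ... | no _  | _     = refl

count-∪ : ∀ {m} {P Q : Pred (Fin m) 0ℓ} (P? : Decidable P) (Q? : Decidable Q) →
          (∀ {x} → P x → ¬ Q x) → count (P? ∪? Q?) ≡ count P? + count Q?
count-∪ {m} P? Q? disjoint = trans (sum-cong-≗ pointwise) (∑-distrib-+ {m} _ _)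
  where
  pointwise : ∀ x → 𝟙 ((P? ∪? Q?) x) ≡ 𝟙 (P? x) + 𝟙 (Q? x)
  pointwise x with P? x | Q? x
  ... | yes px | yes qx = contradiction qx (disjoint px)
  ... | yes _  | no _   = refl
  ... | no _   | yes _  = refl
  ... | no _   | no _   = refl

count-transfer : ∀ {m} {P Q R S : Pred (Fin m) 0ℓ} (P? : Decidable P) (Q? : Decidable Q)
  (R? : Decidable R) (S? : Decidable S) →
  (∀ x → 𝟙 (P? x) + 𝟙 (R? x) ≡ 𝟙 (Q? x) + 𝟙 (S? x)) → count R? ≡ count S? → count P? ≡ count Q?
count-transfer {m} P? Q? R? S? pointwise |R|≡|S| = +-cancelʳ-≡ (count S?) _ _ (begin
  count P? + count S?  ≡⟨ cong (count P? +_) |R|≡|S| ⟨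
  count P? + count R?  ≡⟨ ∑-distrib-+ {m} _ _ ⟨
  ∑[ x < m ] (𝟙 (P? x) + 𝟙 (R? x))  ≡⟨ sum-cong-≗ pointwise ⟩
  ∑[ x < m ] (𝟙 (Q? x) + 𝟙 (S? x))  ≡⟨ ∑-distrib-+ {m} _ _ ⟩
  count Q? + count S?  ∎)
  where open ≡-Reasoning

count-subset : ∀ {m} {P : Pred (Fin m) 0ℓ} (P? : Decidable P) {k} → k ≤ count P? →
               ∃ λ (q : Fin m → Bool) → (∀ {x} → T (q x) → P x) × count (T? ∘ q) ≡ k
count-subset {zero}  P? {zero} _ = (λ ()) , (λ {}) , refl
count-subset {suc m} P? {k} k≤count with P? zero
... | no _ with count-subset (P? ∘ suc) k≤count
...   | q , q⊆P , size = (false ∷ q) , (λ { {suc x} qx → q⊆P qx }) , size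
count-subset {suc m} P? {zero} k≤count | yes _ = (λ _ → false) , (λ ()) , sum-zero {suc m} (λ _ → refl)
count-subset {suc m} P? {suc k} k≤count | yes p0 with count-subset (P? ∘ suc) (≤-pred k≤count)
... | q , q⊆P , size = (true ∷ q) , (λ { {zero} _ → p0 ; {suc x} qx → q⊆P qx }) , cong suc size

module _ {m k} {P : Pred (Fin m) 0ℓ} (P? : Decidable P) {R : Fin m → Fin k → Set}
         (R? : ∀ x y → Dec (R x y)) (partner : ∀ {x} → P x → ∃ (R x)) where

  private
    row : ∀ x → 𝟙 (P? x) ≤ ∑[ y < k ] 𝟙 (R? x y)
    row x = 𝟙-≤ (P? x) λ px → let y , rxy = partner px in
      subst (_≤ _) (𝟙-yes (R? x y) rxy) (≤-sum (λ y → 𝟙 (R? x y)) y)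

  count-≤-∑∑ : count P? ≤ ∑[ x < m ] ∑[ y < k ] 𝟙 (R? x y)
  count-≤-∑∑ = sum-mono-≤ row

  count-<-∑∑ : ∀ {x₀ y₁ y₂} → P x₀ → y₁ ≢ y₂ → R x₀ y₁ → R x₀ y₂ →
               count P? < ∑[ x < m ] ∑[ y < k ] 𝟙 (R? x y)
  count-<-∑∑ {x₀} {y₁} {y₂} px₀ y₁≢y₂ r₁ r₂ =
    sum-mono-< row x₀ (subst (_< _) (sym (𝟙-yes (P? x₀) px₀))
    (≤-trans (≤-reflexive (sym (cong₂ _+_ (𝟙-yes (R? x₀ y₁) r₁) (𝟙-yes (R? x₀ y₂) r₂))))
             (+-≤-sum (λ y → 𝟙 (R? x₀ y)) y₁≢y₂)))

count-≤-injection : ∀ {m k} {P : Pred (Fin m) 0ℓ} {Q : Pred (Fin k) 0ℓ}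
  (P? : Decidable P) (Q? : Decidable Q) {R : Fin m → Fin k → Set} (R? : ∀ x z → Dec (R x z)) →
  (∀ {x} → P x → ∃ λ z → Q z × R x z) →
  (∀ {x x′ z} → P x → P x′ → R x z → R x′ z → x ≡ x′) →
  count P? ≤ count Q?
count-≤-injection {m} {k} {P} {Q} P? Q? {R} R? image injective = begin
  count P?                                ≤⟨ count-≤-∑∑ P? edge? partner ⟩
  ∑[ x < m ] ∑[ z < k ] 𝟙 (edge? x z)     ≡⟨ ∑-comm {m} {k} (λ x z → 𝟙 (edge? x z)) ⟩
  ∑[ z < k ] ∑[ x < m ] 𝟙 (edge? x z)     ≤⟨ sum-mono-≤ column ⟩
  count Q?                                ∎
  where
  open ≤-Reasoning
  edge? : ∀ x z → Dec (P x × Q z × R x z)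
  edge? x z = P? x ×-dec (Q? z ×-dec R? x z)
  partner : ∀ {x} → P x → ∃ λ z → P x × Q z × R x z
  partner px = let z , qz , rxz = image px in z , px , qz , rxz
  column : ∀ z → ∑[ x < m ] 𝟙 (edge? x z) ≤ 𝟙 (Q? z)
  column z = ≤-𝟙 (Q? z)
    (λ _ → count-≤1 (λ x → edge? x z) (λ (px , _ , rxz) (px′ , _ , rx′z) → injective px px′ rxz rx′z))
    (λ ¬qz → count-empty (λ x → edge? x z) (λ x (_ , qz , _) → ¬qz qz))

count-<-pairs : ∀ m → ∑[ x < m ] count {m} (x <?_) ≡ m C 2
count-<-pairs zero    = refl
count-<-pairs (suc m) = begin
  count {suc m} (zero {m} <?_) + ∑[ x < m ] count {m} (x <?_)  ≡⟨ cong₂ _+_ first-row (count-<-pairs m) ⟩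
  m + m C 2                                           ≡⟨ cong (_+ m C 2) (nC1≡n m) ⟨
  m C 1 + m C 2                                       ≡⟨ nCk+nC[k+1]≡[n+1]C[k+1] m 1 ⟩
  suc m C 2                                           ∎
  where
  open ≡-Reasoning
  first-row : count {suc m} (zero {m} <?_) ≡ m
  first-row = trans (sum-cong-≗ {m} (λ y → 𝟙-yes (zero {m} <? suc y) (s≤s z≤n)))
                    (trans (sum-const m 1) (*-identityʳ m))

length-filter-tabulate : ∀ {A : Set} {P : Pred A 0ℓ} (P? : Decidable P) {m} (f : Fin m → A) →
                         length (filter P? (tabulate f)) ≡ ∑[ i < m ] 𝟙 (P? (f i))
length-filter-tabulate P? {zero}  f = refl
length-filter-tabulate P? {suc m} f with does (P? (f zero))
... | true  = cong suc (length-filter-tabulate P? (f ∘ suc))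
... | false = length-filter-tabulate P? (f ∘ suc)

length-filter-concatMap : ∀ {A B : Set} {P : Pred A 0ℓ} (P? : Decidable P) {m} (h : B → List A) (f : Fin m → B) →
  length (filter P? (concatMap h (tabulate f))) ≡ ∑[ i < m ] length (filter P? (h (f i)))
length-filter-concatMap P? {zero}  h f = refl
length-filter-concatMap {A} P? {suc m} h f = begin
  length (filter P? (h (f zero) ++ rest))              ≡⟨ cong length (List.filter-++ P? (h (f zero)) rest) ⟩
  length (filter P? (h (f zero)) ++ filter P? rest)    ≡⟨ List.length-++ (filter P? (h (f zero))) ⟩
  length (filter P? (h (f zero))) + length (filter P? rest)
    ≡⟨ cong (length (filter P? (h (f zero))) +_) (length-filter-concatMap P? h (f ∘ suc)) ⟩
  ∑[ i < suc m ] length (filter P? (h (f i)))          ∎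
  where
  open ≡-Reasoning
  rest : List A
  rest = concatMap h (tabulate (f ∘ suc))

m∸[m∸n]≤n : ∀ m n → m ∸ (m ∸ n) ≤ n
m∸[m∸n]≤n m n = m≤n+o⇒m∸n≤o m (m ∸ n) (≤-trans (m≤n+m∸n m n) (≤-reflexive (+-comm n (m ∸ n))))

m/2+m/2≤m : ∀ m → m / 2 + m / 2 ≤ m
m/2+m/2≤m m = subst (_≤ m) (trans (*-comm (m / 2) 2) (cong (m / 2 +_) (+-identityʳ (m / 2)))) (m/n*n≤m m 2)

n[n∸1]v+nv≡n[nv] : ∀ n v → n * (n ∸ 1) * v + n * v ≡ n * (n * v)
n[n∸1]v+nv≡n[nv] zero    v = refl
n[n∸1]v+nv≡n[nv] (suc k) v = ring k v
  where
  ring : ∀ k v → suc k * k * v + suc k * v ≡ suc k * (suc k * v)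
  ring = solve-∀

-- Relabelling a clique decomposition

module Decomposition {n v : ℕ} (G : Graph (n * v)) (c : Fin (n * v) → Fin n)
  (c-decomposition : IsCliqueDecomposition n v G c)
  (c-unique : ∀ d → IsCliqueDecomposition n v G d → SamePartition c d) (2≤v : 2 ≤ v) where

  V : Set
  V = Fin (n * v)

  Balanced : (V → Fin n) → Set
  Balanced d = ∀ P → count (λ x → d x ≟ P) ≡ v

  IsClique : (V → Fin n) → Set
  IsClique d = ∀ x y → d x ≡ d y → x ≢ y → adj G x y ≡ true

  c-balanced : Balanced c
  c-balanced P = trans (sym (length-filter-tabulate (λ x → c x ≟ P) id)) (proj₁ c-decomposition P)

  c-clique : IsClique c
  c-clique = proj₂ c-decomposition

  preserves-classes : ∀ d → Balanced d → IsClique d → ∀ {a b} → c a ≡ c b → d a ≡ d b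
  preserves-classes d balanced clique {a} {b} = Equivalence.to (c-unique d (class-sizes , clique) a b)
    where
    class-sizes : ∀ P → length (filter (λ x → d x ≟ P) (allFin (n * v))) ≡ v
    class-sizes P = trans (length-filter-tabulate (λ x → d x ≟ P) id) (balanced P)

  clique-if-moved-adjacent : ∀ {d} → IsClique d → ∀ e →
    (∀ x y → e x ≢ d x → e x ≡ e y → x ≢ y → adj G x y ≡ true) → IsClique e
  clique-if-moved-adjacent {d} d-clique e moved x y ex≡ey x≢y with e x ≟ d x | e y ≟ d y
  ... | no x-moved | _          = moved x y x-moved ex≡ey x≢y
  ... | yes _      | no y-moved = trans (Graph.sym G x y) (moved y x y-moved (sym ex≡ey) (x≢y ∘ sym))
  ... | yes ex≡dx  | yes ey≡dy  = d-clique x y (trans (sym ex≡dx) (trans ex≡ey ey≡dy)) x≢y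

  singleton-in-class : ∀ {d : V → Fin n} {a P} → d a ≡ P → ∀ {x} → x ≡ a → d x ≡ P
  singleton-in-class da≡P refl = da≡P

  module Exchange (d : V → Fin n) {A B : Pred V 0ℓ} (A? : Decidable A) (B? : Decidable B)
    {P Q : Fin n} (P≢Q : P ≢ Q) (A⊆P : ∀ {x} → A x → d x ≡ P) (B⊆Q : ∀ {x} → B x → d x ≡ Q) where

    e : V → Fin n
    e x = if does (A? x) then Q else if does (B? x) then P else d x

    private
      disjoint : ∀ {x} → A x → ¬ B x
      disjoint a b = P≢Q (trans (sym (A⊆P a)) (B⊆Q b))

      at-P : ∀ x → 𝟙 (e x ≟ P) + 𝟙 (A? x) ≡ 𝟙 (d x ≟ P) + 𝟙 (B? x)
      at-P x with A? x | B? x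
      ... | yes a | yes b = contradiction b (disjoint a)
      ... | yes a | no _  rewrite A⊆P a | dec-false (Q ≟ P) (P≢Q ∘ sym) | dec-true (P ≟ P) refl = refl
      ... | no _  | yes b rewrite B⊆Q b | dec-false (Q ≟ P) (P≢Q ∘ sym) | dec-true (P ≟ P) refl = refl
      ... | no _  | no _  = refl

      at-Q : ∀ x → 𝟙 (e x ≟ Q) + 𝟙 (B? x) ≡ 𝟙 (d x ≟ Q) + 𝟙 (A? x)
      at-Q x with A? x | B? x
      ... | yes a | yes b = contradiction b (disjoint a)
      ... | yes a | no _  rewrite A⊆P a | dec-false (P ≟ Q) P≢Q | dec-true (Q ≟ Q) refl = refl
      ... | no _  | yes b rewrite B⊆Q b | dec-false (P ≟ Q) P≢Q | dec-true (Q ≟ Q) refl = refl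
      ... | no _  | no _  = refl

      elsewhere : ∀ {i} → i ≢ P → i ≢ Q → ∀ x → 𝟙 (e x ≟ i) ≡ 𝟙 (d x ≟ i)
      elsewhere {i} i≢P i≢Q x with A? x | B? x
      ... | yes a | _     rewrite A⊆P a | dec-false (Q ≟ i) (i≢Q ∘ sym) | dec-false (P ≟ i) (i≢P ∘ sym) = refl
      ... | no _  | yes b rewrite B⊆Q b | dec-false (Q ≟ i) (i≢Q ∘ sym) | dec-false (P ≟ i) (i≢P ∘ sym) = refl
      ... | no _  | no _  = refl

    balanced : count A? ≡ count B? → Balanced d → Balanced e
    balanced |A|≡|B| d-balanced i = trans (preserved i) (d-balanced i)
      where
      preserved : ∀ i → count (λ x → e x ≟ i) ≡ count (λ x → d x ≟ i)
      preserved i with i ≟ P | i ≟ Q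
      ... | yes refl | _        = count-transfer (λ x → e x ≟ i) (λ x → d x ≟ i) A? B? at-P |A|≡|B|
      ... | no _     | yes refl = count-transfer (λ x → e x ≟ i) (λ x → d x ≟ i) B? A? at-Q (sym |A|≡|B|)
      ... | no i≢P   | no i≢Q   = sum-cong-≗ (elsewhere i≢P i≢Q)

    e-A : ∀ {x} → A x → e x ≡ Q
    e-A {x} a with A? x
    ... | yes _ = refl
    ... | no ¬a = contradiction a ¬a

    e-B : ∀ {x} → B x → e x ≡ P
    e-B {x} b with A? x | B? x
    ... | yes a | _     = contradiction b (disjoint a)
    ... | no _  | yes _ = refl
    ... | no _  | no ¬b = contradiction b ¬b

    e-other : ∀ {x} → ¬ A x → ¬ B x → e x ≡ d x
    e-other {x} ¬a ¬b with A? x | B? x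
    ... | yes a | _     = contradiction a ¬a
    ... | no _  | yes b = contradiction b ¬b
    ... | no _  | no _  = refl

    clique : IsClique d →
      (∀ {a z} → A a → d z ≡ Q → ¬ B z → adj G a z ≡ true) →
      (∀ {b x} → B b → d x ≡ P → ¬ A x → adj G b x ≡ true) → IsClique e
    clique d-clique A-to-Q B-to-P = clique-if-moved-adjacent d-clique e moved
      where
      moved : ∀ x y → e x ≢ d x → e x ≡ e y → x ≢ y → adj G x y ≡ true
      -- after the `with`, ex≡ey relates the computed labels (Q, P or d y)
      moved x y x-moved ex≡ey x≢y with A? x | B? x | A? y | B? y
      ... | yes ax | _      | yes ay | _      = d-clique x y (trans (A⊆P ax) (sym (A⊆P ay))) x≢y
      ... | yes _  | _      | no _   | yes _  = contradiction (sym ex≡ey) P≢Q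
      ... | yes ax | _      | no _   | no ¬by = A-to-Q ax (sym ex≡ey) ¬by
      ... | no _   | yes _  | yes _  | _      = contradiction ex≡ey P≢Q
      ... | no _   | yes bx | no _   | yes by = d-clique x y (trans (B⊆Q bx) (sym (B⊆Q by))) x≢y
      ... | no _   | yes bx | no ¬ay | no _   = B-to-P bx (sym ex≡ey) ¬ay
      ... | no _   | no _   | _      | _      = contradiction refl x-moved

  another : ∀ P a → ∃ λ b → c b ≡ P × b ≢ a
  another P a with any? (λ b → (c b ≟ P) ×-dec ¬? (b ≟ a))
  ... | yes found = found
  ... | no none   = contradiction v≤1 (<⇒≱ 2≤v)
    where
    only-a : ∀ {x} → c x ≡ P → x ≡ a
    only-a {x} cx≡P = decidable-stable (x ≟ a) (λ x≢a → none (x , cx≡P , x≢a))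
    v≤1 : v ≤ 1
    v≤1 = subst (_≤ 1) (c-balanced P)
                (≤-trans (count-mono (λ x → c x ≟ P) (_≟ a) only-a) (≤-reflexive (count-singleton a)))

  Full : Fin n → V → Set
  Full Q x = ∀ y → c y ≡ Q → adj G x y ≡ true

  full? : ∀ Q → Decidable (Full Q)
  full? Q x = all? (λ y → (c y ≟ Q) →-dec (adj G x y ≟ᵇ true))

  Misses : Fin n → V → Set
  Misses Q x = ∃ λ y → c y ≡ Q × adj G x y ≡ false

  ¬∀-in-class : ∀ {Q} {R : V → Set} → Decidable R → ¬ (∀ y → c y ≡ Q → R y) →
                ∃ λ y → c y ≡ Q × ¬ R y
  ¬∀-in-class {Q} R? ¬∀ with ¬∀⟶∃¬ _ _ (λ y → (c y ≟ Q) →-dec R? y) ¬∀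
  ... | y , ¬R with c y ≟ Q
  ...   | yes cy≡Q = y , cy≡Q , λ ry → ¬R (λ _ → ry)
  ...   | no cy≢Q  = contradiction (λ cy≡Q → contradiction cy≡Q cy≢Q) ¬R

  ¬full⇒misses : ∀ {Q x} → ¬ Full Q x → Misses Q x
  ¬full⇒misses {x = x} ¬full = let y , cy≡Q , ¬xy = ¬∀-in-class (λ y → adj G x y ≟ᵇ true) ¬full in
    y , cy≡Q , ¬-not ¬xy

  arrow? : ∀ P Q → Dec (Arrow G c P Q)
  arrow? P Q = any? λ x → (c x ≟ P) ×-dec all? (λ y → (c y ≟ Q) →-dec (adj G x y ≟ᵇ false))

  AllMiss : Fin n → Fin n → Set
  AllMiss P Q = ∀ {x} → c x ≡ P → Misses Q x

  no-mutually-full : ∀ {P Q p q} → P ≢ Q → c p ≡ P → c q ≡ Q → Full Q p → Full P q → ⊥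
  no-mutually-full {P} {Q} {p} {q} P≢Q cp≡P cq≡Q p-full q-full with another P p
  ... | p′ , cp′≡P , p′≢p = P≢Q (begin
    P     ≡⟨ cp′≡P ⟨
    c p′  ≡⟨ e-other p′≢p p′≢q ⟨
    e p′  ≡⟨ preserves-classes e e-balanced e-clique (trans cp≡P (sym cp′≡P)) ⟨
    e p   ≡⟨ e-A refl ⟩
    Q     ∎)
    where
    open ≡-Reasoning
    open Exchange c (_≟ p) (_≟ q) P≢Q (singleton-in-class cp≡P) (singleton-in-class cq≡Q)
    e-balanced : Balanced e
    e-balanced = balanced (trans (count-singleton p) (sym (count-singleton q))) c-balanced
    e-clique : IsClique e
    e-clique = clique c-clique (λ { refl cz≡Q _ → p-full _ cz≡Q }) (λ { refl cx≡P _ → q-full _ cx≡P })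
    p′≢q : p′ ≢ q
    p′≢q refl = P≢Q (trans (sym cp′≡P) cq≡Q)

  allMiss-or-allMiss : ∀ {P Q} → P ≢ Q → AllMiss P Q ⊎ AllMiss Q P
  allMiss-or-allMiss {P} {Q} P≢Q with any? (λ p → (c p ≟ P) ×-dec full? Q p)
                                   | any? (λ q → (c q ≟ Q) ×-dec full? P q)
  ... | yes (p , cp≡P , p-full) | yes (q , cq≡Q , q-full) = ⊥-elim (no-mutually-full P≢Q cp≡P cq≡Q p-full q-full)
  ... | no none | _ = inj₁ λ {p} cp≡P → ¬full⇒misses (λ p-full → none (p , cp≡P , p-full))
  ... | _ | no none = inj₂ λ {q} cq≡Q → ¬full⇒misses (λ q-full → none (q , cq≡Q , q-full))

  -- Non-adjacent pairs between two cliques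

  NonAdj : Fin n → Fin n → V → V → Set
  NonAdj P Q x y = c x ≡ P × c y ≡ Q × adj G x y ≡ false

  nonAdj? : ∀ P Q x y → Dec (NonAdj P Q x y)
  nonAdj? P Q x y = (c x ≟ P) ×-dec (c y ≟ Q) ×-dec (adj G x y ≟ᵇ false)

  nonAdj : Fin n → Fin n → ℕ
  nonAdj P Q = ∑[ x < n * v ] ∑[ y < n * v ] 𝟙 (nonAdj? P Q x y)

  module _ {P Q} (all-miss : AllMiss P Q) where

    private
      partner : ∀ {x} → c x ≡ P → ∃ (NonAdj P Q x)
      partner cx≡P = let y , cy≡Q , xy = all-miss cx≡P in y , cx≡P , cy≡Q , xy

    allMiss⇒v≤nonAdj : v ≤ nonAdj P Q
    allMiss⇒v≤nonAdj = subst (_≤ nonAdj P Q) (c-balanced P) (count-≤-∑∑ (λ x → c x ≟ P) (nonAdj? P Q) partner)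

    allMiss⇒v<nonAdj : ∀ {x y₁ y₂} → c x ≡ P → y₁ ≢ y₂ → c y₁ ≡ Q → c y₂ ≡ Q →
                       adj G x y₁ ≡ false → adj G x y₂ ≡ false → v < nonAdj P Q
    allMiss⇒v<nonAdj cx≡P y₁≢y₂ cy₁≡Q cy₂≡Q xy₁ xy₂ = subst (_< nonAdj P Q) (c-balanced P)
      (count-<-∑∑ (λ x → c x ≟ P) (nonAdj? P Q) partner cx≡P y₁≢y₂
                  (cx≡P , cy₁≡Q , xy₁) (cx≡P , cy₂≡Q , xy₂))

  nonAdj-comm : ∀ P Q → nonAdj P Q ≡ nonAdj Q P
  nonAdj-comm P Q = trans (∑-comm {n * v} {n * v} (λ x y → 𝟙 (nonAdj? P Q x y)))
    (sum-cong-≗ λ y → sum-cong-≗ λ x → 𝟙-cong (nonAdj? P Q x y) (nonAdj? Q P y x)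
      (λ (cx , cy , xy) → cy , cx , trans (Graph.sym G y x) xy)
      (λ (cy , cx , yx) → cx , cy , trans (Graph.sym G x y) yx))

  v≤nonAdj : ∀ P Q → v ≤ nonAdj P Q
  v≤nonAdj P Q with P ≟ Q
  ... | yes refl = allMiss⇒v≤nonAdj (λ {x} cx≡P → x , cx≡P , Graph.irrefl G x)
  ... | no P≢Q with allMiss-or-allMiss P≢Q
  ...   | inj₁ P-misses-Q = allMiss⇒v≤nonAdj P-misses-Q
  ...   | inj₂ Q-misses-P = subst (v ≤_) (nonAdj-comm Q P) (allMiss⇒v≤nonAdj Q-misses-P)

  nonAdjacentPairs : ℕ
  nonAdjacentPairs = ∑[ x < n * v ] ∑[ y < n * v ] 𝟙 (adj G x y ≟ᵇ false)

  ∑∑nonAdj : ∑[ P < n ] ∑[ Q < n ] nonAdj P Q ≡ nonAdjacentPairs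
  ∑∑nonAdj = trans (sym (∑∑-comm (λ x y P Q → 𝟙 (nonAdj? P Q x y)))) (sum-cong-≗ λ x → sum-cong-≗ λ y →
    trans (∑-comm {n} {n} (λ P Q → 𝟙 (nonAdj? P Q x y)))
          (trans (sum-cong-≗ {n} (λ Q → ∑-𝟙-≟×-dec (c x) ((c y ≟ Q) ×-dec (adj G x y ≟ᵇ false))))
                 (∑-𝟙-≟×-dec (c y) (adj G x y ≟ᵇ false))))

  adjacent? : ∀ x → Decidable (λ y → adj G x y ≡ true)
  adjacent? x y = adj G x y ≟ᵇ true

  edges nonEdges : ℕ
  edges = ∑[ x < n * v ] count ((x <?_) ∩? adjacent? x)
  nonEdges = ∑[ x < n * v ] count ((x <?_) ∩? ∁? (adjacent? x))

  edgeCount≡edges : edgeCount G ≡ edges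
  edgeCount≡edges = trans (length-filter-concatMap edge? (λ x → List.map (x ,_) (allFin (n * v))) id)
    (sum-cong-≗ λ x → trans (cong (length ∘ filter edge?) (List.map-tabulate id (x ,_)))
                            (length-filter-tabulate edge? (x ,_)))
    where
    edge? : Decidable (λ (x , y) → x Fin.< y × adj G x y ≡ true)
    edge? (x , y) = (x <? y) ×-dec adjacent? x y

  edges+nonEdges : edges + nonEdges ≡ (n * v) C 2
  edges+nonEdges = trans (sym (∑-distrib-+ {n * v} _ _))
    (trans (sum-cong-≗ (λ x → sym (count-split (x <?_) (adjacent? x)))) (count-<-pairs (n * v)))

  nonAdjacentPairs≡ : nonAdjacentPairs ≡ nonEdges + nonEdges + n * v
  nonAdjacentPairs≡ = begin
    nonAdjacentPairs                                                   ≡⟨ ∑∑-cong split ⟩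
    ∑[ x < n * v ] ∑[ y < n * v ] (below x y + below y x + 𝟙 (x ≟ y))
      ≡⟨ ∑∑-distrib-+ (λ x y → below x y + below y x) (λ x y → 𝟙 (x ≟ y)) ⟩
    ∑[ x < n * v ] ∑[ y < n * v ] (below x y + below y x) + diagonal
      ≡⟨ cong (_+ diagonal) (∑∑-distrib-+ below (λ x y → below y x)) ⟩
    nonEdges + ∑[ x < n * v ] ∑[ y < n * v ] below y x + diagonal
      ≡⟨ cong (λ s → nonEdges + s + diagonal) (∑-comm {n * v} {n * v} below) ⟨
    nonEdges + nonEdges + diagonal                                     ≡⟨ cong (nonEdges + nonEdges +_) diagonal≡ ⟩
    nonEdges + nonEdges + n * v                                        ∎
    where
    open ≡-Reasoning
    below : V → V → ℕ
    below x y = 𝟙 ((x <? y) ×-dec ¬? (adjacent? x y))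
    diagonal : ℕ
    diagonal = ∑[ x < n * v ] ∑[ y < n * v ] 𝟙 (x ≟ y)
    diagonal≡ : diagonal ≡ n * v
    diagonal≡ = trans (sum-cong-≗ {n * v} (λ x → count-unique (x ≟_) refl sym))
                      (trans (sum-const (n * v) 1) (*-identityʳ _))
    non-adjacent≡below : ∀ {x y} → x Fin.< y → 𝟙 (adj G x y ≟ᵇ false) ≡ below x y
    non-adjacent≡below {x} {y} x<y = 𝟙-cong (adj G x y ≟ᵇ false) ((x <? y) ×-dec ¬? (adjacent? x y))
      (λ xy → x<y , not-¬ xy) (λ (_ , ¬xy) → ¬-not ¬xy)
    split : ∀ x y → 𝟙 (adj G x y ≟ᵇ false) ≡ below x y + below y x + 𝟙 (x ≟ y)
    split x y with <-cmp x y
    ... | tri< x<y x≢y y≮x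
      rewrite 𝟙-no ((y <? x) ×-dec ¬? (adjacent? y x)) (y≮x ∘ proj₁) | 𝟙-no (x ≟ y) x≢y
      = trans (non-adjacent≡below x<y) (sym (trans (+-identityʳ _) (+-identityʳ _)))
    ... | tri≈ x≮x refl _
      rewrite 𝟙-no ((x <? x) ×-dec ¬? (adjacent? x x)) (x≮x ∘ proj₁) | 𝟙-yes (x ≟ x) refl | Graph.irrefl G x
      = refl
    ... | tri> x≮y x≢y y<x
      rewrite 𝟙-no ((x <? y) ×-dec ¬? (adjacent? x y)) (x≮y ∘ proj₁) | 𝟙-no (x ≟ y) x≢y | Graph.sym G x y
      = trans (non-adjacent≡below y<x) (sym (+-identityʳ _))

  module _ (maximal : Maximal n v G) where

    -- only M + M ≤ n(n−1)v is used, so the truncation in `/ 2` is harmless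
    private
      M : ℕ
      M = n * (n ∸ 1) * v / 2

    nonEdges≤ : nonEdges ≤ M
    nonEdges≤ = begin
      nonEdges                          ≡⟨ m+n∸m≡n edges nonEdges ⟨
      edges + nonEdges ∸ edges          ≡⟨ cong₂ _∸_ edges+nonEdges (trans (sym edgeCount≡edges) maximal) ⟩
      (n * v) C 2 ∸ ((n * v) C 2 ∸ M)  ≤⟨ m∸[m∸n]≤n ((n * v) C 2) M ⟩
      M                                 ∎
      where open ≤-Reasoning

    nonAdjacentPairs≤ : nonAdjacentPairs ≤ n * (n * v)
    nonAdjacentPairs≤ = begin
      nonAdjacentPairs                 ≡⟨ nonAdjacentPairs≡ ⟩
      nonEdges + nonEdges + n * v      ≤⟨ +-monoˡ-≤ (n * v) (+-mono-≤ nonEdges≤ nonEdges≤) ⟩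
      M + M + n * v                    ≤⟨ +-monoˡ-≤ (n * v) (m/2+m/2≤m (n * (n ∸ 1) * v)) ⟩
      n * (n ∸ 1) * v + n * v          ≡⟨ n[n∸1]v+nv≡n[nv] n v ⟩
      n * (n * v)                      ∎
      where open ≤-Reasoning

    nonAdj≤v : ∀ P₀ Q₀ → nonAdj P₀ Q₀ ≤ v
    nonAdj≤v P₀ Q₀ = ≮⇒≥ λ v<nonAdj → <⇒≱ (begin-strict
      n * (n * v)                       ≡⟨ sum-const n (n * v) ⟨
      ∑[ _ < n ] (n * v)                <⟨ sum-mono-< {f = λ _ → n * v} row-bound P₀ (row-strict v<nonAdj) ⟩
      ∑[ P < n ] ∑[ Q < n ] nonAdj P Q  ≡⟨ ∑∑nonAdj ⟩
      nonAdjacentPairs                  ∎) nonAdjacentPairs≤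
      where
      open ≤-Reasoning
      row-bound : ∀ P → n * v ≤ ∑[ Q < n ] nonAdj P Q
      row-bound P = subst (_≤ ∑[ Q < n ] nonAdj P Q) (sum-const n v) (sum-mono-≤ (v≤nonAdj P))
      row-strict : v < nonAdj P₀ Q₀ → n * v < ∑[ Q < n ] nonAdj P₀ Q
      row-strict v<nonAdj = subst (_< ∑[ Q < n ] nonAdj P₀ Q) (sum-const n v) (sum-mono-< (v≤nonAdj P₀) Q₀ v<nonAdj)

    unique-miss : ∀ {P Q} → AllMiss P Q → ∀ {x y₁ y₂} → c x ≡ P → c y₁ ≡ Q → c y₂ ≡ Q →
                  adj G x y₁ ≡ false → adj G x y₂ ≡ false → y₁ ≡ y₂
    unique-miss {P} {Q} all-miss {x} {y₁} {y₂} cx≡P cy₁≡Q cy₂≡Q xy₁ xy₂ =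
      decidable-stable (y₁ ≟ y₂) λ y₁≢y₂ →
      <⇒≱ (allMiss⇒v<nonAdj all-miss cx≡P y₁≢y₂ cy₁≡Q cy₂≡Q xy₁ xy₂) (nonAdj≤v P Q)

    -- Transitivity

    module Transitivity {X Y Z} (X≢Y : X ≢ Y) (Y≢Z : Y ≢ Z) (X≢Z : X ≢ Z)
      {x₀} (cx₀≡X : c x₀ ≡ X) (x₀-misses-Y : ∀ y → c y ≡ Y → adj G x₀ y ≡ false)
      {y₀} (cy₀≡Y : c y₀ ≡ Y) (y₀-misses-Z : ∀ z → c z ≡ Z → adj G y₀ z ≡ false) where

      y₀-sees-X : ∀ {x} → c x ≡ X → x ≢ x₀ → adj G y₀ x ≡ true
      y₀-sees-X cx≡X x≢x₀ = ¬-not λ y₀x →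
        x≢x₀ (unique-miss Y-misses-X cy₀≡Y cx≡X cx₀≡X y₀x (y-misses-x₀ cy₀≡Y))
        where
        y-misses-x₀ : ∀ {y} → c y ≡ Y → adj G y x₀ ≡ false
        y-misses-x₀ {y} cy≡Y = trans (Graph.sym G y x₀) (x₀-misses-Y y cy≡Y)
        Y-misses-X : AllMiss Y X
        Y-misses-X cy≡Y = x₀ , cx₀≡X , y-misses-x₀ cy≡Y

      Z-sees-Y : ∀ {z y} → c z ≡ Z → c y ≡ Y → y ≢ y₀ → adj G z y ≡ true
      Z-sees-Y cz≡Z cy≡Y y≢y₀ = ¬-not λ zy →
        y≢y₀ (unique-miss Z-misses-Y cz≡Z cy≡Y cy₀≡Y zy (z-misses-y₀ cz≡Z))
        where
        z-misses-y₀ : ∀ {z} → c z ≡ Z → adj G z y₀ ≡ false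
        z-misses-y₀ {z} cz≡Z = trans (Graph.sym G z y₀) (y₀-misses-Z z cz≡Z)
        Z-misses-Y : AllMiss Z Y
        Z-misses-Y cz≡Z = y₀ , cy₀≡Y , z-misses-y₀ cz≡Z

      module Rotation {z} (cz≡Z : c z ≡ Z) where

        private
          z≢x₀ : z ≢ x₀
          z≢x₀ refl = X≢Z (trans (sym cx₀≡X) cz≡Z)
          z≢y₀ : z ≢ y₀
          z≢y₀ refl = Y≢Z (trans (sym cy₀≡Y) cz≡Z)
          y₀≢x₀ : y₀ ≢ x₀
          y₀≢x₀ refl = X≢Y (trans (sym cx₀≡X) cy₀≡Y)

          module E₁ = Exchange c (_≟ x₀) (_≟ y₀) X≢Y (singleton-in-class cx₀≡X) (singleton-in-class cy₀≡Y)
          module E₂ = Exchange E₁.e (_≟ x₀) (_≟ z) Y≢Z (singleton-in-class (E₁.e-A refl))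
                                                        (singleton-in-class (trans (E₁.e-other z≢x₀ z≢y₀) cz≡Z))

        rotate : V → Fin n
        rotate = E₂.e

        rotate-balanced : Balanced rotate
        rotate-balanced = E₂.balanced (trans (count-singleton x₀) (sym (count-singleton z)))
                            (E₁.balanced (trans (count-singleton x₀) (sym (count-singleton y₀))) c-balanced)

        rotate-x₀ : rotate x₀ ≡ Z
        rotate-x₀ = E₂.e-A refl

        rotate-y₀ : rotate y₀ ≡ X
        rotate-y₀ = trans (E₂.e-other y₀≢x₀ (z≢y₀ ∘ sym)) (E₁.e-B refl)

        rotate-z : rotate z ≡ Y
        rotate-z = E₂.e-B refl

        rotate-fixed : ∀ {y} → y ≢ x₀ → y ≢ y₀ → y ≢ z → rotate y ≡ c y
        rotate-fixed y≢x₀ y≢y₀ y≢z = trans (E₂.e-other y≢x₀ y≢z) (E₁.e-other y≢x₀ y≢y₀)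

        classify : ∀ y → y ≡ x₀ ⊎ y ≡ y₀ ⊎ y ≡ z ⊎ (y ≢ x₀ × y ≢ y₀ × y ≢ z)
        classify y with y ≟ x₀ | y ≟ y₀ | y ≟ z
        ... | yes y≡x₀ | _        | _       = inj₁ y≡x₀
        ... | no _     | yes y≡y₀ | _       = inj₂ (inj₁ y≡y₀)
        ... | no _     | no _     | yes y≡z = inj₂ (inj₂ (inj₁ y≡z))
        ... | no y≢x₀  | no y≢y₀  | no y≢z  = inj₂ (inj₂ (inj₂ (y≢x₀ , y≢y₀ , y≢z)))

        into-Z : ∀ {y} → rotate y ≡ Z → y ≡ x₀ ⊎ (c y ≡ Z × y ≢ z)
        into-Z {y} ry≡Z with classify y
        ... | inj₁ y≡x₀                            = inj₁ y≡x₀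
        ... | inj₂ (inj₁ refl)                     = contradiction (trans (sym rotate-y₀) ry≡Z) X≢Z
        ... | inj₂ (inj₂ (inj₁ refl))              = contradiction (trans (sym rotate-z) ry≡Z) Y≢Z
        ... | inj₂ (inj₂ (inj₂ (y≢x₀ , y≢y₀ , y≢z))) =
          inj₂ (trans (sym (rotate-fixed y≢x₀ y≢y₀ y≢z)) ry≡Z , y≢z)

        into-X : ∀ {y} → rotate y ≡ X → y ≡ y₀ ⊎ (c y ≡ X × y ≢ x₀)
        into-X {y} ry≡X with classify y
        ... | inj₁ refl                            = contradiction (trans (sym ry≡X) rotate-x₀) X≢Z
        ... | inj₂ (inj₁ y≡y₀)                     = inj₁ y≡y₀
        ... | inj₂ (inj₂ (inj₁ refl))              = contradiction (trans (sym ry≡X) rotate-z) X≢Y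
        ... | inj₂ (inj₂ (inj₂ (y≢x₀ , y≢y₀ , y≢z))) =
          inj₂ (trans (sym (rotate-fixed y≢x₀ y≢y₀ y≢z)) ry≡X , y≢x₀)

        into-Y : ∀ {y} → rotate y ≡ Y → y ≡ z ⊎ (c y ≡ Y × y ≢ y₀)
        into-Y {y} ry≡Y with classify y
        ... | inj₁ refl                            = contradiction (trans (sym rotate-x₀) ry≡Y) (Y≢Z ∘ sym)
        ... | inj₂ (inj₁ refl)                     = contradiction (trans (sym rotate-y₀) ry≡Y) X≢Y
        ... | inj₂ (inj₂ (inj₁ y≡z))               = inj₁ y≡z
        ... | inj₂ (inj₂ (inj₂ (y≢x₀ , y≢y₀ , y≢z))) =
          inj₂ (trans (sym (rotate-fixed y≢x₀ y≢y₀ y≢z)) ry≡Y , y≢y₀)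

        rotate-clique : (∀ {y} → c y ≡ Z → y ≢ z → adj G x₀ y ≡ true) → IsClique rotate
        rotate-clique x₀-sees-Z = clique-if-moved-adjacent c-clique rotate moved
          where
          moved : ∀ w y → rotate w ≢ c w → rotate w ≡ rotate y → w ≢ y → adj G w y ≡ true
          moved w y w-moved rw≡ry w≢y with classify w
          ... | inj₁ refl with into-Z {y} (trans (sym rw≡ry) rotate-x₀)
          ...   | inj₁ refl          = contradiction refl w≢y
          ...   | inj₂ (cy≡Z , y≢z)  = x₀-sees-Z cy≡Z y≢z
          moved w y w-moved rw≡ry w≢y | inj₂ (inj₁ refl) with into-X {y} (trans (sym rw≡ry) rotate-y₀)
          ...   | inj₁ refl          = contradiction refl w≢y
          ...   | inj₂ (cy≡X , y≢x₀) = y₀-sees-X cy≡X y≢x₀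
          moved w y w-moved rw≡ry w≢y | inj₂ (inj₂ (inj₁ refl)) with into-Y {y} (trans (sym rw≡ry) rotate-z)
          ...   | inj₁ refl          = contradiction refl w≢y
          ...   | inj₂ (cy≡Y , y≢y₀) = Z-sees-Y cz≡Z cy≡Y y≢y₀
          moved w y w-moved rw≡ry w≢y | inj₂ (inj₂ (inj₂ (w≢x₀ , w≢y₀ , w≢z))) =
            contradiction (rotate-fixed w≢x₀ w≢y₀ w≢z) w-moved

        no-rotation : (∀ {y} → c y ≡ Z → y ≢ z → adj G x₀ y ≡ true) → ⊥
        no-rotation x₀-sees-Z with another X x₀
        ... | x′ , cx′≡X , x′≢x₀
            with into-Z (trans (sym (preserves-classes rotate rotate-balanced (rotate-clique x₀-sees-Z)
                                                          (trans cx₀≡X (sym cx′≡X))))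
                               rotate-x₀)
        ...   | inj₁ x′≡x₀       = x′≢x₀ x′≡x₀
        ...   | inj₂ (cx′≡Z , _) = X≢Z (trans (sym cx′≡X) cx′≡Z)

      -- A vertex of X ∖ {x₀} not adjacent to all of Z is the only miss in X of some vertex of Z seen
      -- by x₀. So at least |Missed| − 1 vertices of X ∖ {x₀} are adjacent to all of Z: together with
      -- x₀ they can be exchanged with Missed.
      module Swap (Z-misses-X : AllMiss Z X) where

        Missed Seen Others : Pred V 0ℓ
        Missed = (λ z → c z ≡ Z) ∩ (λ z → adj G x₀ z ≡ false)
        Seen   = (λ z → c z ≡ Z) ∩ ∁ (λ z → adj G x₀ z ≡ false)
        Others = (λ x → c x ≡ X) ∩ ∁ (_≡ x₀)

        missed? : Decidable Missed
        missed? = (λ z → c z ≟ Z) ∩? (λ z → adj G x₀ z ≟ᵇ false)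

        seen? : Decidable Seen
        seen? = (λ z → c z ≟ Z) ∩? ∁? (λ z → adj G x₀ z ≟ᵇ false)

        others? : Decidable Others
        others? = (λ x → c x ≟ X) ∩? ∁? (_≟ x₀)

        full-others? : Decidable (Others ∩ Full Z)
        full-others? = others? ∩? full? Z

        partial-others? : Decidable (Others ∩ ∁ (Full Z))
        partial-others? = others? ∩? ∁? (full? Z)

        same-miss : ∀ {z x x′} → c z ≡ Z → c x ≡ X → c x′ ≡ X →
                    adj G x z ≡ false → adj G x′ z ≡ false → x ≡ x′
        same-miss {z} {x} {x′} cz≡Z cx≡X cx′≡X xz x′z =
          unique-miss Z-misses-X cz≡Z cx≡X cx′≡X (trans (Graph.sym G z x) xz) (trans (Graph.sym G z x′) x′z)

        partial≤seen : count partial-others? ≤ count seen?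
        partial≤seen = count-≤-injection partial-others? seen? (λ x z → (c z ≟ Z) ×-dec (adj G x z ≟ᵇ false))
          (λ ((cx≡X , x≢x₀) , ¬full) → let z , cz≡Z , xz = ¬full⇒misses ¬full in
            z , (cz≡Z , λ x₀z → x≢x₀ (same-miss cz≡Z cx≡X cx₀≡X xz x₀z)) , cz≡Z , xz)
          (λ ((cx≡X , _) , _) ((cx′≡X , _) , _) (cz≡Z , xz) (_ , x′z) → same-miss cz≡Z cx≡X cx′≡X xz x′z)

        missed≤1+full : count missed? ≤ suc (count full-others?)
        missed≤1+full = +-cancelʳ-≤ (count seen?) _ _ (begin
          count missed? + count seen?                    ≡⟨ trans (sym size-Z) size-X ⟩
          suc (count full-others? + count partial-others?) ≤⟨ s≤s (+-monoʳ-≤ (count full-others?) partial≤seen) ⟩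
          suc (count full-others?) + count seen?          ∎)
          where
          open ≤-Reasoning
          size-X : v ≡ suc (count full-others? + count partial-others?)
          size-X = begin-equality
            v                                                   ≡⟨ c-balanced X ⟨
            count (λ x → c x ≟ X)                               ≡⟨ count-split (λ x → c x ≟ X) (_≟ x₀) ⟩
            count ((λ x → c x ≟ X) ∩? (_≟ x₀)) + count others?
              ≡⟨ cong₂ _+_ (count-unique ((λ x → c x ≟ X) ∩? (_≟ x₀)) (cx₀≡X , refl) proj₂)
                           (count-split others? (full? Z)) ⟩
            suc (count full-others? + count partial-others?)    ∎
          size-Z : v ≡ count missed? + count seen?
          size-Z = trans (sym (c-balanced Z)) (count-split (λ z → c z ≟ Z) (λ z → adj G x₀ z ≟ᵇ false))

        module Swapped (q : V → Bool) (q⊆full-others : ∀ {x} → T (q x) → (Others ∩ Full Z) x)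
                       (|q| : count (T? ∘ q) ≡ count missed? ∸ 1) (1≤missed : 1 ≤ count missed?) where

          Moving : Pred V 0ℓ
          Moving = (_≡ x₀) ∪ (T ∘ q)

          moving? : Decidable Moving
          moving? = (_≟ x₀) ∪? (T? ∘ q)

          moving⊆X : ∀ {x} → Moving x → c x ≡ X
          moving⊆X (inj₁ refl) = cx₀≡X
          moving⊆X (inj₂ qx)   = proj₁ (proj₁ (q⊆full-others qx))

          |moving|≡|missed| : count moving? ≡ count missed?
          |moving|≡|missed| = begin
            count moving?                   ≡⟨ count-∪ (_≟ x₀) (T? ∘ q) x₀-stays ⟩
            count (_≟ x₀) + count (T? ∘ q)  ≡⟨ cong₂ _+_ (count-singleton x₀) |q| ⟩
            suc (count missed? ∸ 1)         ≡⟨ m+[n∸m]≡n 1≤missed ⟩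
            count missed?                   ∎
            where
            open ≡-Reasoning
            x₀-stays : ∀ {x} → x ≡ x₀ → ¬ T (q x)
            x₀-stays refl qx₀ = proj₂ (proj₁ (q⊆full-others qx₀)) refl

          open Exchange c moving? missed? X≢Z moving⊆X proj₁ public

          swap-balanced : Balanced e
          swap-balanced = balanced |moving|≡|missed| c-balanced

          swap-clique : IsClique e
          swap-clique = clique c-clique
            (λ { (inj₁ refl) cz≡Z ¬missed → ¬-not (λ x₀z → ¬missed (cz≡Z , x₀z))
               ; (inj₂ qa)   cz≡Z _       → proj₂ (q⊆full-others qa) _ cz≡Z })
            (λ { {b} {x} (cb≡Z , x₀b) cx≡X ¬moving → ¬-not λ bx →
                 ¬moving (inj₁ (same-miss cb≡Z cx≡X cx₀≡X (trans (Graph.sym G x b) bx) x₀b)) })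

        no-swap : ∀ {z₁} → c z₁ ≡ Z → adj G x₀ z₁ ≡ false → ¬ Arrow G c X Z → ⊥
        no-swap {z₁} cz₁≡Z x₀z₁ ¬arrow
          with count-subset full-others? (m≤n+o⇒m∸n≤o _ 1 missed≤1+full)
             | ¬∀-in-class (λ y → adj G x₀ y ≟ᵇ false) (λ x₀-misses-Z →
                 ¬arrow (x₀ , cx₀≡X , x₀-misses-Z))
        ... | q , q⊆full-others , |q| | zs , czs≡Z , x₀-sees-zs = X≢Z (begin
          X     ≡⟨ e-B (cz₁≡Z , x₀z₁) ⟨
          e z₁  ≡⟨ preserves-classes e swap-balanced swap-clique (trans cz₁≡Z (sym czs≡Z)) ⟩
          e zs  ≡⟨ e-other (λ m → X≢Z (trans (sym (moving⊆X m)) czs≡Z)) (x₀-sees-zs ∘ proj₂) ⟩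
          c zs  ≡⟨ czs≡Z ⟩
          Z     ∎)
          where
          open ≡-Reasoning
          1≤missed : 1 ≤ count missed?
          1≤missed = subst (_≤ count missed?) (𝟙-yes (missed? z₁) (cz₁≡Z , x₀z₁))
                           (≤-sum (𝟙 ∘ missed?) z₁)
          open Swapped q q⊆full-others |q| 1≤missed

      X→Z : Arrow G c X Z
      X→Z = decidable-stable (arrow? X Z) ¬¬X→Z
        where
        ¬¬X→Z : ¬ ¬ Arrow G c X Z
        ¬¬X→Z ¬X→Z with allMiss-or-allMiss X≢Z
        ... | inj₁ X-misses-Z = let z , cz≡Z , x₀z = X-misses-Z cx₀≡X in
          Rotation.no-rotation cz≡Z λ cy≡Z y≢z → ¬-not λ x₀y →
            y≢z (unique-miss X-misses-Z cx₀≡X cy≡Z cz≡Z x₀y x₀z)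
        ... | inj₂ Z-misses-X with any? (λ z → (c z ≟ Z) ×-dec (adj G x₀ z ≟ᵇ false))
        ...   | yes (z₁ , cz₁≡Z , x₀z₁) = Swap.no-swap Z-misses-X cz₁≡Z x₀z₁ ¬X→Z
        ...   | no x₀-sees-Z = Rotation.no-rotation (proj₁ (proj₂ (another Z x₀)))
                                 λ {y} cy≡Z _ → ¬-not λ x₀y → x₀-sees-Z (y , cy≡Z , x₀y)

lemma3p5 : (n v : ℕ) → 3 ≤ n → 2 ≤ v → (G : Graph (n * v))
    → WeaklyCliquePartitioned n v G → Maximal n v G
    → (c : Fin (n * v) → Fin n) → IsCliqueDecomposition n v G c
    → (X Y Z : Fin n) → ¬ (X ≡ Y) → ¬ (Y ≡ Z) → ¬ (X ≡ Z)
    → Arrow G c X Y → Arrow G c Y Z → Arrow G c X Z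
lemma3p5 n v _ 2≤v G (_ , unique) maximal c c-decomposition X Y Z X≢Y Y≢Z X≢Z
  (x₀ , cx₀≡X , x₀-misses-Y) (y₀ , cy₀≡Y , y₀-misses-Z) =
  Transitivity.X→Z maximal X≢Y Y≢Z X≢Z cx₀≡X x₀-misses-Y cy₀≡Y y₀-misses-Z
  where open Decomposition G c c-decomposition (λ d → unique c d c-decomposition) 2≤v
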